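{- Let $b_i=\frac{c_i}{\mathbb E[X_i]}$ for each type $i$ and let $m=\arg\min_i b_i$. Then for all integers $w$ with $-W+1\le w\le W$, \[b_m\,w\le OPT_w\le b_m\,(w+W).\]
   Context: Fix integers $n\ge1$, $W\ge1$. There are $n$ item types; type $i$ has deterministic cost $c_i>0$ and a random weight $X_i$ with distribution supported in $\{1,\dots,W\}$ (standing assumption: positive integer weights). Let $d_i(k)=\Pr[X_i=k]$. Define $OPT_w=0$ for integers $w\le 0$ and, for $w=1,\dots,W$, $OPT_w=\min_{1\le j\le n}\big(c_j+\sum_{k=1}^{W}d_j(k)OPT_{w-k}\big)$; $OPT_w$ is the minimum expected total cost of adaptively inserting independent items of these types (infinitely many of each, weights revealed upon insertion) until the total weight is at least $w$.
   Formalization: The costs $c_i$ and the probabilities $d_i(k)$ are rational. -}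

module Defs where

open import Data.Nat as ℕ using (ℕ; zero; suc; _∸_; _≤ᵇ_)
open import Data.Integer as ℤ using (ℤ; +_; -[1+_])
open import Data.Fin using (Fin; zero; suc; toℕ)
open import Data.Bool using (if_then_else_)
open import Data.Rational using (ℚ; 0ℚ; _+_; _*_; _⊓_; 1/_; _/_; ≢-nonZero)
open import Data.Rational.Properties using (_≟_)
open import Relation.Nullary using (yes; no)

ΣFin : (k : ℕ) → (Fin k → ℚ) → ℚ
ΣFin zero    f = 0ℚ
ΣFin (suc k) f = f zero + ΣFin k (λ i → f (suc i))

-- minimum over Fin k (only meaningful for k ≥ 1; value 0 for k = 0)
minFin : (k : ℕ) → (Fin k → ℚ) → ℚ
minFin zero          f = 0ℚ
minFin (suc zero)    f = f zero
minFin (suc (suc k)) f = f zero ⊓ minFin (suc k) (λ i → f (suc i))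

ℕ→ℚ : ℕ → ℚ
ℕ→ℚ k = (+ k) / 1

ℤ→ℚ : ℤ → ℚ
ℤ→ℚ z = z / 1

-- total reciprocal (0 at 0); only applied to positive expectations
inv : ℚ → ℚ
inv q with q ≟ 0ℚ
... | yes _  = 0ℚ
... | no q≢0 = 1/_ q {{≢-nonZero q≢0}}

-- Index k : Fin W stands for weight (toℕ k + 1) ∈ {1,…,W}.
weight : {W : ℕ} → Fin W → ℕ
weight k = suc (toℕ k)

expect : (n W : ℕ) → (d : Fin n → Fin W → ℚ) → Fin n → ℚ
expect n W d i = ΣFin W (λ k → ℕ→ℚ (weight k) * d i k)

ratio : (n W : ℕ) → (c : Fin n → ℚ) → (d : Fin n → Fin W → ℚ) → Fin n → ℚ
ratio n W c d i = c i * inv (expect n W d i)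

-- optUpto t x = OPT_x for 0 ≤ x ≤ t (OPT_0 = 0).
-- Note OPT_{w-k} for w ≥ 0, k ≥ 1 equals OPT_{w ∸ k}, since OPT_v = 0 for v ≤ 0.
optUpto : (n W : ℕ) → (c : Fin n → ℚ) → (d : Fin n → Fin W → ℚ) → ℕ → ℕ → ℚ
optUpto n W c d zero    x = 0ℚ
optUpto n W c d (suc t) x =
  if x ≤ᵇ t then optUpto n W c d t x
  else minFin n (λ j → c j + ΣFin W (λ k → d j k * optUpto n W c d t (suc t ∸ weight k)))

OPTℕ : (n W : ℕ) → (c : Fin n → ℚ) → (d : Fin n → Fin W → ℚ) → ℕ → ℚ
OPTℕ n W c d w = optUpto n W c d w w

OPT : (n W : ℕ) → (c : Fin n → ℚ) → (d : Fin n → Fin W → ℚ) → ℤ → ℚ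
OPT n W c d (+ w)      = OPTℕ n W c d w
OPT n W c d -[1+ _ ]   = 0ℚ

{-# OPTIONS --safe #-}
module Submission where

-- Let b = c_m / E[X_m], the least ratio. The Bellman equation expresses OPT_w through the
-- residuals OPT_{w−k} with 1 ≤ k ≤ W, so both bounds follow by strong induction on w; for
-- residuals w − k ≤ 0 they hold because OPT vanishes there and k ≤ W. Starting with an item of
-- type j costs c_j ≥ b E[X_j] and leaves an expected residual cost of at least b (w − E[X_j]),
-- hence at least b w in total. Starting with type m costs exactly b E[X_m] and leaves at most
-- b (w + W − E[X_m]), hence OPT_w ≤ b (w + W).

open import Defs
open import Data.Bool using (true; false)
open import Data.Empty using (⊥-elim)
open import Data.Fin using (Fin; zero; suc; toℕ)
import Data.Fin.Properties as Fin
open import Data.Integer as ℤ using (ℤ; +_; -[1+_])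
import Data.Integer.Properties as ℤ
import Data.Integer.Solver as ℤ-Solver
open import Data.Nat as ℕ using (ℕ; zero; suc; _∸_; z≤n; s≤s)
open import Data.Nat.Divisibility using (∣1⇒≡1)
open import Data.Nat.Induction using (<-rec)
import Data.Nat.Properties as ℕ
open import Data.Product using (_×_; _,_; proj₁; proj₂)
open import Data.Rational
open import Data.Rational.Properties
open import Data.Rational.Solver using (module +-*-Solver)
open import Data.Sum using (inj₁; inj₂)
open import Function using (_∘_)
open import Relation.Binary.PropositionalEquality
open import Relation.Nullary using (yes; no; ofʸ; ofⁿ)

-- Exposing the denominator 1 lets _+_ and _≤_ on ℚ compute on numerators.
ℤ→ℚ≡mkℚ : ∀ a → ℤ→ℚ a ≡ mkℚ a 0 (λ (_ , d∣1) → ∣1⇒≡1 d∣1)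
ℤ→ℚ≡mkℚ a = ↥p/↧p≡p (mkℚ a 0 (λ (_ , d∣1) → ∣1⇒≡1 d∣1))

ℤ→ℚ-homo-+ : ∀ a b → ℤ→ℚ (a ℤ.+ b) ≡ ℤ→ℚ a + ℤ→ℚ b
ℤ→ℚ-homo-+ a b rewrite ℤ→ℚ≡mkℚ a | ℤ→ℚ≡mkℚ b =
  cong (_/ 1) (sym (cong₂ ℤ._+_ (ℤ.*-identityʳ a) (ℤ.*-identityʳ b)))

ℤ→ℚ-mono-≤ : ∀ {a b} → a ℤ.≤ b → ℤ→ℚ a ≤ ℤ→ℚ b
ℤ→ℚ-mono-≤ {a} {b} a≤b rewrite ℤ→ℚ≡mkℚ a | ℤ→ℚ≡mkℚ b =
  *≤* (subst₂ ℤ._≤_ (sym (ℤ.*-identityʳ a)) (sym (ℤ.*-identityʳ b)) a≤b)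

ℕ→ℚ-homo-+ : ∀ m n → ℕ→ℚ (m ℕ.+ n) ≡ ℕ→ℚ m + ℕ→ℚ n
ℕ→ℚ-homo-+ m n = ℤ→ℚ-homo-+ (+ m) (+ n)

ℕ→ℚ-mono-≤ : ∀ {m n} → m ℕ.≤ n → ℕ→ℚ m ≤ ℕ→ℚ n
ℕ→ℚ-mono-≤ m≤n = ℤ→ℚ-mono-≤ (ℤ.+≤+ m≤n)

ℕ→ℚ-homo-∸ : ∀ {m n} → n ℕ.≤ m → ℕ→ℚ (m ∸ n) ≡ ℕ→ℚ m - ℕ→ℚ n
ℕ→ℚ-homo-∸ {m} {n} n≤m = begin
  ℕ→ℚ (m ∸ n)                          ≡⟨ solve 2 (λ r s → r := r :+ s :- s) refl
                                                    (ℕ→ℚ (m ∸ n)) (ℕ→ℚ n) ⟩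
  ℕ→ℚ (m ∸ n) + ℕ→ℚ n - ℕ→ℚ n          ≡⟨ cong (_- ℕ→ℚ n) (ℕ→ℚ-homo-+ (m ∸ n) n) ⟨
  ℕ→ℚ (m ∸ n ℕ.+ n) - ℕ→ℚ n            ≡⟨ cong (λ k → ℕ→ℚ k - ℕ→ℚ n) (ℕ.m∸n+n≡m n≤m) ⟩
  ℕ→ℚ m - ℕ→ℚ n                        ∎
  where open ≡-Reasoning; open +-*-Solver

inv-inverseˡ : ∀ {q} → 0ℚ < q → inv q * q ≡ 1ℚ
inv-inverseˡ {q} 0<q with q ≟ 0ℚ
... | yes refl = ⊥-elim (<-irrefl refl 0<q)
... | no q≢0   = *-inverseˡ q {{≢-nonZero q≢0}}

ΣFin-cong : ∀ K {f g : Fin K → ℚ} → (∀ k → f k ≡ g k) → ΣFin K f ≡ ΣFin K g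
ΣFin-cong zero    f≗g = refl
ΣFin-cong (suc K) f≗g = cong₂ _+_ (f≗g zero) (ΣFin-cong K (λ k → f≗g (suc k)))

ΣFin-mono-≤ : ∀ K {f g : Fin K → ℚ} → (∀ k → f k ≤ g k) → ΣFin K f ≤ ΣFin K g
ΣFin-mono-≤ zero    f≤g = ≤-refl
ΣFin-mono-≤ (suc K) f≤g = +-mono-≤ (f≤g zero) (ΣFin-mono-≤ K (λ k → f≤g (suc k)))

ΣFin-affine : ∀ K (d x : Fin K → ℚ) b P →
  ΣFin K (λ k → d k * (b * (P - x k))) ≡ b * (P * ΣFin K d - ΣFin K (λ k → x k * d k))
ΣFin-affine zero    d x b P = solve 2 (λ b P → con 0ℚ := b :* (P :* con 0ℚ :- con 0ℚ)) refl b P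
  where open +-*-Solver
ΣFin-affine (suc K) d x b P rewrite ΣFin-affine K (λ k → d (suc k)) (λ k → x (suc k)) b P =
  solve 6 (λ d₀ x₀ b P S T → d₀ :* (b :* (P :- x₀)) :+ b :* (P :* S :- T)
                            := b :* (P :* (d₀ :+ S) :- (x₀ :* d₀ :+ T))) refl
    (d zero) (x zero) b P (ΣFin K (λ k → d (suc k))) (ΣFin K (λ k → x (suc k) * d (suc k)))
  where open +-*-Solver

ΣFin-≤-weighted : ∀ K {d x : Fin K → ℚ} → (∀ k → 0ℚ ≤ d k) → (∀ k → 1ℚ ≤ x k) →
  ΣFin K d ≤ ΣFin K (λ k → x k * d k)
ΣFin-≤-weighted K {d} {x} 0≤d 1≤x = ΣFin-mono-≤ K (λ k →
  subst (_≤ x k * d k) (*-identityˡ (d k)) (*-monoʳ-≤-nonNeg (d k) {{nonNegative (0≤d k)}} (1≤x k)))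

minFin-cong : ∀ K {f g : Fin K → ℚ} → (∀ i → f i ≡ g i) → minFin K f ≡ minFin K g
minFin-cong zero          f≗g = refl
minFin-cong (suc zero)    f≗g = f≗g zero
minFin-cong (suc (suc K)) f≗g = cong₂ _⊓_ (f≗g zero) (minFin-cong (suc K) (λ i → f≗g (suc i)))

minFin-≤ : ∀ K (f : Fin K → ℚ) i → minFin K f ≤ f i
minFin-≤ (suc zero)    f zero    = ≤-refl
minFin-≤ (suc (suc K)) f zero    = p⊓q≤p _ _
minFin-≤ (suc (suc K)) f (suc i) = ≤-trans (p⊓q≤q (f zero) _) (minFin-≤ (suc K) (λ i → f (suc i)) i)

minFin-greatest : ∀ {K} → 1 ℕ.≤ K → (f : Fin K → ℚ) {q : ℚ} → (∀ i → q ≤ f i) → q ≤ minFin K f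
minFin-greatest {suc zero}    _ f q≤f = q≤f zero
minFin-greatest {suc (suc K)} _ f q≤f =
  ⊓-glb (q≤f zero) (minFin-greatest (s≤s z≤n) (λ i → f (suc i)) (λ i → q≤f (suc i)))

p≤q⇒p-q≤0 : ∀ {p q} → p ≤ q → p - q ≤ 0ℚ
p≤q⇒p-q≤0 {p} {q} p≤q = subst (p - q ≤_) (+-inverseʳ q) (+-monoˡ-≤ (- q) p≤q)

p≤q⇒0≤q-p : ∀ {p q} → p ≤ q → 0ℚ ≤ q - p
p≤q⇒0≤q-p {p} {q} p≤q = subst (_≤ q - p) (+-inverseʳ p) (+-monoˡ-≤ (- p) p≤q)

1+n≰ᵇn : ∀ n → (suc n ℕ.≤ᵇ n) ≡ false
1+n≰ᵇn n with suc n ℕ.≤ᵇ n | ℕ.≤ᵇ-reflects-≤ (suc n) n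
... | false | _          = refl
... | true  | ofʸ 1+n≤n = ⊥-elim (ℕ.<-irrefl refl 1+n≤n)

module _ (n W : ℕ) (c : Fin n → ℚ) (d : Fin n → Fin W → ℚ) where

  optUpto-stable : ∀ t {x} → x ℕ.≤ t → optUpto n W c d t x ≡ OPTℕ n W c d x
  optUpto-stable zero    z≤n = refl
  optUpto-stable (suc t) {x} x≤1+t with ℕ.m≤n⇒m<n∨m≡n x≤1+t
  ... | inj₂ refl        = refl
  ... | inj₁ (s≤s x≤t) with x ℕ.≤ᵇ t | ℕ.≤ᵇ-reflects-≤ x t
  ...   | true  | _       = optUpto-stable t x≤t
  ...   | false | ofⁿ x≰t = ⊥-elim (x≰t x≤t)

  OPTℕ-bellman : ∀ y → OPTℕ n W c d (suc y) ≡
    minFin n (λ j → c j + ΣFin W (λ k → d j k * OPTℕ n W c d (suc y ∸ weight k)))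
  OPTℕ-bellman y rewrite 1+n≰ᵇn y =
    minFin-cong n (λ j → cong (λ s → c j + s) (ΣFin-cong W (λ k →
      cong (d j k *_) (optUpto-stable y (ℕ.m∸n≤m y (toℕ k))))))

module Bounds (n W : ℕ) (n≥1 : 1 ℕ.≤ n)
    (c : Fin n → ℚ) (c>0 : ∀ i → 0ℚ < c i)
    (d : Fin n → Fin W → ℚ) (d≥0 : ∀ i k → 0ℚ ≤ d i k) (Σd≡1 : ∀ i → ΣFin W (d i) ≡ 1ℚ)
    (m : Fin n) (m-minimal : ∀ j → ratio n W c d m ≤ ratio n W c d j) where

  b : ℚ
  b = ratio n W c d m

  E : Fin n → ℚ
  E = expect n W d

  O : ℕ → ℚ
  O = OPTℕ n W c d

  wt : Fin W → ℚ
  wt k = ℕ→ℚ (weight k)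

  expect>0 : ∀ j → 0ℚ < E j
  expect>0 j = <-≤-trans (positive⁻¹ 1ℚ)
    (subst (_≤ E j) (Σd≡1 j) (ΣFin-≤-weighted W (d≥0 j) (λ k → ℕ→ℚ-mono-≤ {1} {weight k} (s≤s z≤n))))

  ratio*expect : ∀ j → ratio n W c d j * E j ≡ c j
  ratio*expect j = begin
    c j * inv (E j) * E j    ≡⟨ *-assoc (c j) (inv (E j)) (E j) ⟩
    c j * (inv (E j) * E j)  ≡⟨ cong (c j *_) (inv-inverseˡ (expect>0 j)) ⟩
    c j * 1ℚ                 ≡⟨ *-identityʳ (c j) ⟩
    c j                      ∎
    where open ≡-Reasoning

  b*expect≤cost : ∀ j → b * E j ≤ c j
  b*expect≤cost j = subst (b * E j ≤_) (ratio*expect j)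
    (*-monoʳ-≤-nonNeg (E j) {{nonNegative (<⇒≤ (expect>0 j))}} (m-minimal j))

  b>0 : 0ℚ < b
  b>0 = *-cancelʳ-<-nonNeg (E m) {{nonNegative (<⇒≤ (expect>0 m))}}
    (subst₂ _<_ (sym (*-zeroˡ (E m))) (sym (ratio*expect m)) (c>0 m))

  instance
    b-nonNeg : NonNegative b
    b-nonNeg = nonNegative (<⇒≤ b>0)

  b*-≥0 : ∀ {q} → 0ℚ ≤ q → 0ℚ ≤ b * q
  b*-≥0 {q} 0≤q = subst (_≤ b * q) (*-zeroʳ b) (*-monoˡ-≤-nonNeg b 0≤q)

  b*-≤0 : ∀ {q} → q ≤ 0ℚ → b * q ≤ 0ℚ
  b*-≤0 {q} q≤0 = subst (b * q ≤_) (*-zeroʳ b) (*-monoˡ-≤-nonNeg b q≤0)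

  expect-affine : ∀ j P → ΣFin W (λ k → d j k * (b * (P - wt k))) ≡ b * (P - E j)
  expect-affine j P = begin
    ΣFin W (λ k → d j k * (b * (P - wt k)))  ≡⟨ ΣFin-affine W (d j) wt b P ⟩
    b * (P * ΣFin W (d j) - E j)             ≡⟨ cong (λ s → b * (P * s - E j)) (Σd≡1 j) ⟩
    b * (P * 1ℚ - E j)                       ≡⟨ cong (λ s → b * (s - E j)) (*-identityʳ P) ⟩
    b * (P - E j)                            ∎
    where open ≡-Reasoning

  expect-residual-≥ : ∀ j P {f : Fin W → ℚ} → (∀ k → b * (P - wt k) ≤ f k) →
    b * (P - E j) ≤ ΣFin W (λ k → d j k * f k)
  expect-residual-≥ j P f≥ = subst (_≤ _) (expect-affine j P)
    (ΣFin-mono-≤ W (λ k → *-monoˡ-≤-nonNeg (d j k) {{nonNegative (d≥0 j k)}} (f≥ k)))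

  expect-residual-≤ : ∀ j P {f : Fin W → ℚ} → (∀ k → f k ≤ b * (P - wt k)) →
    ΣFin W (λ k → d j k * f k) ≤ b * (P - E j)
  expect-residual-≤ j P f≤ = subst (_ ≤_) (expect-affine j P)
    (ΣFin-mono-≤ W (λ k → *-monoˡ-≤-nonNeg (d j k) {{nonNegative (d≥0 j k)}} (f≤ k)))

  split-at : ∀ e P → b * e + b * (P - e) ≡ b * P
  split-at e P = solve 3 (λ b e P → b :* e :+ b :* (P :- e) := b :* P) refl b e P
    where open +-*-Solver

  Bracketed : ℕ → Set
  Bracketed x = b * ℕ→ℚ x ≤ O x × O x ≤ b * (ℕ→ℚ x + ℕ→ℚ W)

  residual-bracketed : ∀ x → (∀ {r} → r ℕ.< x → Bracketed r) → ∀ k →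
    b * (ℕ→ℚ x - wt k) ≤ O (x ∸ weight k) × O (x ∸ weight k) ≤ b * ((ℕ→ℚ x + ℕ→ℚ W) - wt k)
  residual-bracketed x ih k with weight k ℕ.≤? x
  ... | yes w≤x = subst (λ q → b * q ≤ O r) r≡x-w (proj₁ r-bracketed)
                , subst (λ q → O r ≤ b * q) r+W≡x+W-w (proj₂ r-bracketed)
    where
    r : ℕ
    r = x ∸ weight k
    r-bracketed : Bracketed r
    r-bracketed = ih (ℕ.∸-monoʳ-< {x} {weight k} {0} (s≤s z≤n) w≤x)
    r≡x-w : ℕ→ℚ r ≡ ℕ→ℚ x - wt k
    r≡x-w = ℕ→ℚ-homo-∸ w≤x
    r+W≡x+W-w : ℕ→ℚ r + ℕ→ℚ W ≡ (ℕ→ℚ x + ℕ→ℚ W) - wt k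
    r+W≡x+W-w = trans (cong (_+ ℕ→ℚ W) r≡x-w)
      (solve 3 (λ X V U → X :- V :+ U := X :+ U :- V) refl (ℕ→ℚ x) (wt k) (ℕ→ℚ W))
      where open +-*-Solver
  ... | no w≰x = subst (_ ≤_) (sym O-r≡0) (b*-≤0 (p≤q⇒p-q≤0 x≤w))
               , subst (_≤ _) (sym O-r≡0) (b*-≥0 (p≤q⇒0≤q-p w≤x+W))
    where
    x<w : x ℕ.< weight k
    x<w = ℕ.≰⇒> w≰x
    O-r≡0 : O (x ∸ weight k) ≡ 0ℚ
    O-r≡0 = cong O (ℕ.m≤n⇒m∸n≡0 (ℕ.<⇒≤ x<w))
    x≤w : ℕ→ℚ x ≤ wt k
    x≤w = ℕ→ℚ-mono-≤ (ℕ.<⇒≤ x<w)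
    w≤x+W : wt k ≤ ℕ→ℚ x + ℕ→ℚ W
    w≤x+W = subst (wt k ≤_) (ℕ→ℚ-homo-+ x W) (ℕ→ℚ-mono-≤ (ℕ.≤-trans (Fin.toℕ<n k) (ℕ.m≤n+m W x)))

  bracketed-zero : Bracketed 0
  bracketed-zero = ≤-reflexive (*-zeroʳ b)
                 , b*-≥0 (subst (0ℚ ≤_) (sym (+-identityˡ (ℕ→ℚ W))) (ℕ→ℚ-mono-≤ {0} {W} z≤n))

  bracketed-suc : ∀ y → (∀ {r} → r ℕ.< suc y → Bracketed r) → Bracketed (suc y)
  bracketed-suc y ih = subst (b * X ≤_) (sym bellman) lower
                     , subst (_≤ b * (X + ℕ→ℚ W)) (sym bellman) upper
    where
    X : ℚ
    X = ℕ→ℚ (suc y)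
    residual-cost : Fin n → ℚ
    residual-cost j = ΣFin W (λ k → d j k * O (suc y ∸ weight k))
    insert : Fin n → ℚ
    insert j = c j + residual-cost j
    bellman : O (suc y) ≡ minFin n insert
    bellman = OPTℕ-bellman n W c d y
    residual : ∀ k → b * (X - wt k) ≤ O (suc y ∸ weight k)
                   × O (suc y ∸ weight k) ≤ b * ((X + ℕ→ℚ W) - wt k)
    residual = residual-bracketed (suc y) ih
    lower : b * X ≤ minFin n insert
    lower = minFin-greatest n≥1 insert λ j → begin
      b * X                    ≡⟨ split-at (E j) X ⟨
      b * E j + b * (X - E j)  ≤⟨ +-mono-≤ (b*expect≤cost j) (expect-residual-≥ j X (proj₁ ∘ residual)) ⟩
      insert j                 ∎
      where open ≤-Reasoning
    upper : minFin n insert ≤ b * (X + ℕ→ℚ W)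
    upper = begin
      minFin n insert                    ≤⟨ minFin-≤ n insert m ⟩
      c m + residual-cost m              ≡⟨ cong (_+ residual-cost m) (ratio*expect m) ⟨
      b * E m + residual-cost m          ≤⟨ +-monoʳ-≤ (b * E m) (expect-residual-≤ m (X + ℕ→ℚ W) (proj₂ ∘ residual)) ⟩
      b * E m + b * (X + ℕ→ℚ W - E m)    ≡⟨ split-at (E m) (X + ℕ→ℚ W) ⟩
      b * (X + ℕ→ℚ W)                    ∎
      where open ≤-Reasoning

  bracketed : ∀ x → Bracketed x
  bracketed = <-rec Bracketed λ where
    zero    _  → bracketed-zero
    (suc y) ih → bracketed-suc y ih

  OPT-bounds : ∀ w → ℤ.- (+ W) ℤ.+ (+ 1) ℤ.≤ w →
    (b * ℤ→ℚ w ≤ OPT n W c d w) × (OPT n W c d w ≤ b * ℤ→ℚ (w ℤ.+ + W))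
  OPT-bounds (+ x) _ =
    proj₁ (bracketed x)
    , subst (λ q → O x ≤ b * q) (sym (ℤ→ℚ-homo-+ (+ x) (+ W))) (proj₂ (bracketed x))
  OPT-bounds -[1+ v ] -W+1≤w =
    b*-≤0 (ℤ→ℚ-mono-≤ { -[1+ v ]} {+ 0} ℤ.-≤+) , b*-≥0 (ℤ→ℚ-mono-≤ 0≤w+W)
    where
    -W+1+W≡1 : ℤ.- (+ W) ℤ.+ (+ 1) ℤ.+ + W ≡ + 1
    -W+1+W≡1 = solve 1 (λ V → :- V :+ con (+ 1) :+ V := con (+ 1)) refl (+ W)
      where open ℤ-Solver.+-*-Solver
    0≤w+W : + 0 ℤ.≤ -[1+ v ] ℤ.+ + W
    0≤w+W = ℤ.≤-trans (ℤ.+≤+ {0} {1} z≤n)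
      (subst (ℤ._≤ -[1+ v ] ℤ.+ + W) -W+1+W≡1 (ℤ.+-monoˡ-≤ (+ W) -W+1≤w))

-- The bounds hold for every w ≥ −W + 1.
lemma1 : (n W : ℕ) → 1 ℕ.≤ n → 1 ℕ.≤ W →
    (c : Fin n → ℚ) → (∀ i → 0ℚ < c i) →
    (d : Fin n → Fin W → ℚ) → (∀ i k → 0ℚ ≤ d i k) → (∀ i → ΣFin W (d i) ≡ 1ℚ) →
    (m : Fin n) → (∀ j → ratio n W c d m ≤ ratio n W c d j) →
    (w : ℤ) → ℤ.- (+ W) ℤ.+ (+ 1) ℤ.≤ w → w ℤ.≤ + W →
    (ratio n W c d m * ℤ→ℚ w ≤ OPT n W c d w)
      × (OPT n W c d w ≤ ratio n W c d m * ℤ→ℚ (w ℤ.+ + W))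
lemma1 n W n≥1 _ c c>0 d d≥0 Σd≡1 m m-minimal w -W+1≤w _ =
  Bounds.OPT-bounds n W n≥1 c c>0 d d≥0 Σd≡1 m m-minimal w -W+1≤w
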